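{- For every positive integer $s$ and every integer $q\ge 0$, the following identity holds (as an identity of rational functions in $x$, i.e. for all real $x$ with $F_s(x)\neq 0$): \[ (-1)^{sq}F_s(x)\sum_{n=0}^{q}(-1)^{sn}\,n\,F_{2sn}(x)=\frac{1}{x^2+4}\left(\frac{(-1)^{s+1}}{F_s(x)}F_{2sq}(x)+qL_{s(2q+1)}(x)\right). \]
   Context: Fibonacci polynomials: $F_0(x)=0$, $F_1(x)=1$, $F_{n+1}(x)=xF_n(x)+F_{n-1}(x)$. Lucas polynomials: $L_0(x)=2$, $L_1(x)=x$, $L_{n+1}(x)=xL_n(x)+L_{n-1}(x)$.
   Formalization: The variable x ranges over the rationals with $F_s(x)\neq 0$ rather than over all real x. -}

module Defs where

open import Data.Nat using (ℕ; zero; suc)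
open import Data.Integer using (+_)
open import Data.Rational using (ℚ; 0ℚ; 1ℚ; _+_; _*_; -_; _/_; NonZero; NonNegative; Positive)
open import Data.Rational.Properties
  using (≤-total; nonNeg*nonNeg⇒nonNeg; nonPos*nonPos⇒nonPos; nonNeg+pos⇒pos; pos⇒nonZero)
open import Data.Rational.Base using (nonNegative; nonPositive)
open import Data.Sum using (inj₁; inj₂)

F : ℕ → ℚ → ℚ
F zero x = 0ℚ
F (suc zero) x = 1ℚ
F (suc (suc n)) x = x * F (suc n) x + F n x

L : ℕ → ℚ → ℚ
L zero x = + 2 / 1
L (suc zero) x = x
L (suc (suc n)) x = x * L (suc n) x + L n x

sgn : ℕ → ℚ
sgn zero = 1ℚ
sgn (suc k) = - sgn k

ℕ→ℚ : ℕ → ℚ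
ℕ→ℚ n = + n / 1

Σ0to : ℕ → (ℕ → ℚ) → ℚ
Σ0to zero f = f 0
Σ0to (suc q) f = Σ0to q f + f (suc q)

x²+4 : ℚ → ℚ
x²+4 x = x * x + + 4 / 1

x²+4-nonZero : ∀ x → NonZero (x²+4 x)
x²+4-nonZero x with ≤-total 0ℚ x
... | inj₁ 0≤x =
  let instance _ = nonNegative 0≤x
      instance _ = nonNeg*nonNeg⇒nonNeg x x
      instance _ = nonNeg+pos⇒pos (x * x) (+ 4 / 1)
  in pos⇒nonZero (x²+4 x)
... | inj₂ x≤0 =
  let instance _ = nonPositive x≤0
      instance _ = nonPos*nonPos⇒nonPos x x
      instance _ = nonNeg+pos⇒pos (x * x) (+ 4 / 1)
  in pos⇒nonZero (x²+4 x)

-- We first develop the theory of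
-- sequences G obeying the Fibonacci recurrence G(n+2) = x G(n+1) + G(n):
-- the addition formula G(n+k) = F_k G(n+1) + F_{k-1} G(n), Cassini's
-- identity, and from these the "double shift"
--   G(n+2k) = (-1)^k G(n) + F_k (2 G(n+k+1) - x G(n+k)).
-- For G = F the bracket is L_{n+k}, for G = L it is (x²+4) F_{n+k}.
-- The theorem, with denominators cleared, is then proved by induction on q:
-- the step q → q+1 combines the recursion of the sum with the two double
-- shifts for k = s.

module Submission where

open import Defs
open import Data.Nat using (ℕ; zero; suc; _≤_) renaming (_+_ to _+ℕ_; _*_ to _*ℕ_)
open import Data.Nat.Properties using (+-identityʳ; +-suc; +-assoc; +-comm; *-suc; *-zeroʳ)
import Data.Nat.Tactic.RingSolver as ℕ-Ring
open import Data.Integer using (+_) renaming (_+_ to _+ℤ_; _*_ to _*ℤ_)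
import Data.Integer.Tactic.RingSolver as ℤ-Ring
open import Data.Rational
  using (ℚ; 0ℚ; 1ℚ; _+_; _*_; -_; _-_; _/_; 1/_; _÷_; NonZero; ≢-nonZero; toℚᵘ)
open import Data.Rational.Properties
  using (_≟_; +-*-commutativeRing; *-identityˡ; *-identityʳ; *-inverseʳ; neg-distribˡ-*;
         toℚᵘ-injective; toℚᵘ-homo-+; toℚᵘ-fromℚᵘ)
import Data.Rational.Unnormalised as ℚᵘ
import Data.Rational.Unnormalised.Properties as ℚᵘP
open import Level using (0ℓ)
open import Tactic.RingSolver using (solve-∀)
open import Tactic.RingSolver.Core.AlmostCommutativeRing
  using (AlmostCommutativeRing; fromCommutativeRing)
open import Relation.Nullary.Decidable.Core using (dec⇒maybe)
open import Relation.Binary.PropositionalEquality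
open ≡-Reasoning

-- ℚ packaged for the reflective ring solver; zero coefficients are
-- recognised with decidable equality so that normal forms are canonical.
ℚ-ring : AlmostCommutativeRing 0ℓ 0ℓ
ℚ-ring = fromCommutativeRing +-*-commutativeRing (λ p → dec⇒maybe (0ℚ ≟ p))

FibLike : ℚ → (ℕ → ℚ) → Set
FibLike x G = ∀ n → G (suc (suc n)) ≡ x * G (suc n) + G n

F-fibLike : ∀ x → FibLike x (λ n → F n x)
F-fibLike x n = refl

L-fibLike : ∀ x → FibLike x (λ n → L n x)
L-fibLike x n = refl

-- F_{k-1}(x), written without subtraction of indices; at k = 0 it is the
-- value F_{-1} = 1 obtained by running the recurrence backwards.
Fpred : ℕ → ℚ → ℚ
Fpred k x = F (suc k) x - x * F k x

addition : ∀ {x G} → FibLike x G → ∀ n k →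
           G (n +ℕ k) ≡ F k x * G (suc n) + Fpred k x * G n
addition {x} {G} rec n zero = begin
  G (n +ℕ 0)                           ≡⟨ cong G (+-identityʳ n) ⟩
  G n                                  ≡⟨ base x (G (suc n)) (G n) ⟩
  0ℚ * G (suc n) + Fpred 0 x * G n     ∎
  where
  base : ∀ x g₁ g₀ → g₀ ≡ 0ℚ * g₁ + (1ℚ - x * 0ℚ) * g₀
  base = solve-∀ ℚ-ring
addition {x} {G} rec n (suc k) = begin
  G (n +ℕ suc k)                                          ≡⟨ cong G (+-suc n k) ⟩
  G (suc n +ℕ k)                                          ≡⟨ addition rec (suc n) k ⟩
  F k x * G (suc (suc n)) + Fpred k x * G (suc n)         ≡⟨ cong (λ g → F k x * g + Fpred k x * G (suc n)) (rec n) ⟩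
  F k x * (x * G (suc n) + G n) + Fpred k x * G (suc n)   ≡⟨ regroup x (F k x) (F (suc k) x) (G (suc n)) (G n) ⟩
  F (suc k) x * G (suc n) + Fpred (suc k) x * G n         ∎
  where
  regroup : ∀ x a b g₁ g₀ →
            a * (x * g₁ + g₀) + (b - x * a) * g₁ ≡ b * g₁ + ((x * b + a) - x * b) * g₀
  regroup = solve-∀ ℚ-ring

lucas-via-fib : ∀ x n → L n x ≡ (+ 2 / 1) * F (suc n) x - x * F n x
lucas-via-fib x n = begin
  L n x                                        ≡⟨ addition (L-fibLike x) 0 n ⟩
  F n x * x + Fpred n x * (+ 2 / 1)            ≡⟨ collect x (F n x) (F (suc n) x) ⟩
  (+ 2 / 1) * F (suc n) x - x * F n x          ∎
  where
  collect : ∀ x a b → a * x + (b - x * a) * (+ 2 / 1) ≡ (+ 2 / 1) * b - x * a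
  collect = solve-∀ ℚ-ring

cassini : ∀ x k → sgn k ≡ F (suc k) x * Fpred k x - F k x * F k x
cassini x zero = unit x
  where
  unit : ∀ x → 1ℚ ≡ 1ℚ * (1ℚ - x * 0ℚ) - 0ℚ * 0ℚ
  unit = solve-∀ ℚ-ring
cassini x (suc k) = begin
  - sgn k                                                  ≡⟨ cong -_ (cassini x k) ⟩
  - (F (suc k) x * Fpred k x - F k x * F k x)              ≡⟨ flip x (F k x) (F (suc k) x) ⟩
  F (suc (suc k)) x * Fpred (suc k) x - F (suc k) x * F (suc k) x ∎
  where
  flip : ∀ x a b → - (b * (b - x * a) - a * a) ≡ (x * b + a) * ((x * b + a) - x * b) - b * b
  flip = solve-∀ ℚ-ring

-- d'Ocagne-type identity: (-1)^k G(n) = F_{k+1} G(n+k) - F_k G(n+k+1).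
-- Both values on the right are expanded by the addition formula; what is
-- left is Cassini's identity times G(n).
sign-shift : ∀ {x G} → FibLike x G → ∀ n k →
             sgn k * G n ≡ F (suc k) x * G (n +ℕ k) - F k x * G (suc (n +ℕ k))
sign-shift {x} {G} rec n k = begin
  sgn k * G n
    ≡⟨ cong (_* G n) (cassini x k) ⟩
  (b * (b - x * a) - a * a) * G n
    ≡⟨ expand x a b (G (suc n)) (G n) ⟩
  b * (a * G (suc n) + (b - x * a) * G n) - a * (a * (x * G (suc n) + G n) + (b - x * a) * G (suc n))
    ≡⟨ cong₂ (λ u v → b * u - a * (a * v + (b - x * a) * G (suc n)))
             (sym (addition rec n k)) (sym (rec n)) ⟩
  b * G (n +ℕ k) - a * (a * G (suc (suc n)) + Fpred k x * G (suc n))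
    ≡⟨ cong (λ v → b * G (n +ℕ k) - a * v) (sym (addition rec (suc n) k)) ⟩
  b * G (n +ℕ k) - a * G (suc (n +ℕ k)) ∎
  where
  a = F k x
  b = F (suc k) x
  expand : ∀ x a b g₁ g₀ →
           (b * (b - x * a) - a * a) * g₀
             ≡ b * (a * g₁ + (b - x * a) * g₀) - a * (a * (x * g₁ + g₀) + (b - x * a) * g₁)
  expand = solve-∀ ℚ-ring

-- The conjugate of a solution G: the sequence G(m+1) + G(m-1) = 2G(m+1) - xG(m).
conjugate : ℚ → (ℕ → ℚ) → ℕ → ℚ
conjugate x G m = (+ 2 / 1) * G (suc m) - x * G m

-- Double shift: G(n+2k) = (-1)^k G(n) + F_k G*(n+k), where G* is the conjugate.
-- Apply the addition formula at n+k and replace the (-1)^k G(n) term by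
-- d'Ocagne's identity.
double-shift : ∀ {x G} → FibLike x G → ∀ n k →
               G (n +ℕ (k +ℕ k)) ≡ sgn k * G n + F k x * conjugate x G (n +ℕ k)
double-shift {x} {G} rec n k = begin
  G (n +ℕ (k +ℕ k))                         ≡⟨ cong G (sym (+-assoc n k k)) ⟩
  G (m +ℕ k)                                ≡⟨ addition rec m k ⟩
  a * G (suc m) + Fpred k x * G m           ≡⟨ split x a b (G (suc m)) (G m) ⟩
  (b * G m - a * G (suc m)) + a * conjugate x G m
                                            ≡⟨ cong (_+ a * conjugate x G m) (sym (sign-shift rec n k)) ⟩
  sgn k * G n + a * conjugate x G m         ∎
  where
  m = n +ℕ k
  a = F k x
  b = F (suc k) x
  split : ∀ x a b g₁ g₀ →
          a * g₁ + (b - x * a) * g₀ ≡ (b * g₀ - a * g₁) + a * ((+ 2 / 1) * g₁ - x * g₀)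
  split = solve-∀ ℚ-ring

conjugate-L : ∀ x m → conjugate x (λ n → L n x) m ≡ x²+4 x * F m x
conjugate-L x m = begin
  (+ 2 / 1) * L (suc m) x - x * L m x
    ≡⟨ cong₂ (λ u v → (+ 2 / 1) * u - x * v) (lucas-via-fib x (suc m)) (lucas-via-fib x m) ⟩
  (+ 2 / 1) * ((+ 2 / 1) * F (suc (suc m)) x - x * F (suc m) x)
    - x * ((+ 2 / 1) * F (suc m) x - x * F m x)
    ≡⟨ simplify x (F m x) (F (suc m) x) ⟩
  x²+4 x * F m x ∎
  where
  simplify : ∀ x a b →
             (+ 2 / 1) * ((+ 2 / 1) * (x * b + a) - x * b) - x * ((+ 2 / 1) * b - x * a)
               ≡ (x * x + + 4 / 1) * a
  simplify = solve-∀ ℚ-ring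

F-double-shift : ∀ x n k →
                 F (n +ℕ (k +ℕ k)) x ≡ sgn k * F n x + F k x * L (n +ℕ k) x
F-double-shift x n k = begin
  F (n +ℕ (k +ℕ k)) x                                   ≡⟨ double-shift (F-fibLike x) n k ⟩
  sgn k * F n x + F k x * conjugate x (λ i → F i x) (n +ℕ k)
                                                        ≡⟨ cong (λ c → sgn k * F n x + F k x * c) (sym (lucas-via-fib x (n +ℕ k))) ⟩
  sgn k * F n x + F k x * L (n +ℕ k) x                  ∎

L-double-shift : ∀ x n k →
                 L (n +ℕ (k +ℕ k)) x ≡ sgn k * L n x + F k x * (x²+4 x * F (n +ℕ k) x)
L-double-shift x n k = begin
  L (n +ℕ (k +ℕ k)) x                                   ≡⟨ double-shift (L-fibLike x) n k ⟩
  sgn k * L n x + F k x * conjugate x (λ i → L i x) (n +ℕ k)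
                                                        ≡⟨ cong (λ c → sgn k * L n x + F k x * c) (conjugate-L x (n +ℕ k)) ⟩
  sgn k * L n x + F k x * (x²+4 x * F (n +ℕ k) x)       ∎

sgn-+ : ∀ a b → sgn (a +ℕ b) ≡ sgn a * sgn b
sgn-+ zero    b = sym (*-identityˡ (sgn b))
sgn-+ (suc a) b = trans (cong -_ (sgn-+ a b)) (neg-distribˡ-* (sgn a) (sgn b))

sgn-squared : ∀ a → sgn a * sgn a ≡ 1ℚ
sgn-squared zero    = refl
sgn-squared (suc a) = trans (negate-twice (sgn a)) (sgn-squared a)
  where
  negate-twice : ∀ e → (- e) * (- e) ≡ e * e
  negate-twice = solve-∀ ℚ-ring

-- The embedding ℕ → ℚ commutes with the successor; checked in ℚᵘ, where
-- addition needs no normalisation.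
ℕ→ℚ-suc : ∀ n → ℕ→ℚ (suc n) ≡ ℕ→ℚ n + 1ℚ
ℕ→ℚ-suc n = toℚᵘ-injective (≃.begin
  toℚᵘ (ℕ→ℚ (suc n))                       ≃.≈⟨ toℚᵘ-fromℚᵘ (ℚᵘ.mkℚᵘ (+ suc n) 0) ⟩
  ℚᵘ.mkℚᵘ (+ suc n) 0                      ≃.≈⟨ ℚᵘ.*≡* (cross-multiplied (+ n)) ⟩
  ℚᵘ.mkℚᵘ (+ n) 0 ℚᵘ.+ toℚᵘ 1ℚ             ≃.≈⟨ ℚᵘP.+-congˡ (toℚᵘ 1ℚ) (ℚᵘP.≃-sym (toℚᵘ-fromℚᵘ (ℚᵘ.mkℚᵘ (+ n) 0))) ⟩
  toℚᵘ (ℕ→ℚ n) ℚᵘ.+ toℚᵘ 1ℚ                ≃.≈⟨ ℚᵘP.≃-sym (toℚᵘ-homo-+ (ℕ→ℚ n) 1ℚ) ⟩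
  toℚᵘ (ℕ→ℚ n + 1ℚ)                        ≃.∎)
  where
  module ≃ = ℚᵘP.≃-Reasoning
  cross-multiplied : ∀ m → (+ 1 +ℤ m) *ℤ + 1 ≡ (m *ℤ + 1 +ℤ + 1 *ℤ + 1) *ℤ + 1
  cross-multiplied = ℤ-Ring.solve-∀

summand : ℕ → ℚ → ℕ → ℚ
summand s x n = sgn (s *ℕ n) * ℕ→ℚ n * F (2 *ℕ s *ℕ n) x

lhs : ℕ → ℚ → ℕ → ℚ
lhs s x q = sgn (s *ℕ q) * F s x * Σ0to q (summand s x)

-- Recursion for the left-hand side: the sign prefactor flips by (-1)^s and
-- absorbs the sign of the new summand.
lhs-suc : ∀ s x q →
          lhs s x (suc q) ≡ sgn s * lhs s x q + (ℕ→ℚ q + 1ℚ) * F s x * F (2 *ℕ s *ℕ suc q) x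
lhs-suc s x q = begin
  σ * Fs * (S + σ * ℕ→ℚ (suc q) * G)
    ≡⟨ cong₂ (λ σ′ n → σ′ * Fs * (S + σ′ * n * G))
             (trans (cong sgn (*-suc s q)) (sgn-+ s (s *ℕ q))) (ℕ→ℚ-suc q) ⟩
  (ε * e) * Fs * (S + (ε * e) * N * G)
    ≡⟨ expand ε e Fs S N G ⟩
  ε * (e * Fs * S) + (ε * ε) * (e * e) * (N * Fs * G)
    ≡⟨ cong₂ (λ u v → ε * (e * Fs * S) + u * v * (N * Fs * G)) (sgn-squared s) (sgn-squared (s *ℕ q)) ⟩
  ε * (e * Fs * S) + 1ℚ * 1ℚ * (N * Fs * G)
    ≡⟨ cong (λ t → ε * (e * Fs * S) + t) (drop-units (N * Fs * G)) ⟩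
  ε * (e * Fs * S) + N * Fs * G ∎
  where
  σ = sgn (s *ℕ suc q)
  ε = sgn s
  e = sgn (s *ℕ q)
  Fs = F s x
  S = Σ0to q (summand s x)
  N = ℕ→ℚ q + 1ℚ
  G = F (2 *ℕ s *ℕ suc q) x
  expand : ∀ ε e f S N G →
           (ε * e) * f * (S + (ε * e) * N * G) ≡ ε * (e * f * S) + (ε * ε) * (e * e) * (N * f * G)
  expand = solve-∀ ℚ-ring
  drop-units : ∀ a → 1ℚ * 1ℚ * a ≡ a
  drop-units = solve-∀ ℚ-ring

-- The algebra of one induction step, over arbitrary rationals.  In the
-- application D = x²+4, ε = (-1)^s, f = F_s, N = q, T = lhs at q,
-- F₀ = F_{2sq}, L₀ = L_{s(2q+1)}; N′, T′, F₁, L₁ are the corresponding values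
-- at q+1, related to the old ones by lhs-suc and the two double shifts.
invariant-step : ∀ {D ε f T N F₀ L₀ N′ T′ F₁ L₁} →
                 N′ ≡ N + 1ℚ →
                 T′ ≡ ε * T + (N + 1ℚ) * f * F₁ →
                 F₁ ≡ ε * F₀ + f * L₀ →
                 L₁ ≡ ε * L₀ + f * (D * F₁) →
                 D * T * f ≡ (- ε) * F₀ + N * L₀ * f →
                 D * T′ * f ≡ (- ε) * F₁ + N′ * L₁ * f
invariant-step {D} {ε} {f} {T} {N} {F₀} {L₀} refl refl refl refl hyp = begin
  D * (ε * T + (N + 1ℚ) * f * F₁) * f         ≡⟨ expand D ε f T N F₁ ⟩
  ε * (D * T * f) + R                         ≡⟨ cong (λ t → ε * t + R) hyp ⟩
  ε * ((- ε) * F₀ + N * L₀ * f) + R           ≡⟨ collect D ε f N F₀ L₀ ⟩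
  (- ε) * F₁ + (N + 1ℚ) * (ε * L₀ + f * (D * F₁)) * f ∎
  where
  F₁ = ε * F₀ + f * L₀
  R = (N + 1ℚ) * (f * (D * F₁)) * f
  expand : ∀ D ε f T N G →
           D * (ε * T + (N + 1ℚ) * f * G) * f ≡ ε * (D * T * f) + (N + 1ℚ) * (f * (D * G)) * f
  expand = solve-∀ ℚ-ring
  collect : ∀ D ε f N F₀ L₀ →
            ε * ((- ε) * F₀ + N * L₀ * f) + (N + 1ℚ) * (f * (D * (ε * F₀ + f * L₀))) * f
              ≡ (- ε) * (ε * F₀ + f * L₀)
                + (N + 1ℚ) * (ε * L₀ + f * (D * (ε * F₀ + f * L₀))) * f
  collect = solve-∀ ℚ-ring

-- The theorem with both denominators cleared, by induction on q.
-- Note sgn (suc s) is by definition - sgn s.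
invariant : ∀ s x q →
            x²+4 x * lhs s x q * F s x
              ≡ sgn (suc s) * F (2 *ℕ s *ℕ q) x + ℕ→ℚ q * L (s *ℕ (2 *ℕ q +ℕ 1)) x * F s x
invariant s x zero = begin
  x²+4 x * (sgn (s *ℕ 0) * F s x * (sgn (s *ℕ 0) * 0ℚ * F (2 *ℕ s *ℕ 0) x)) * F s x
    ≡⟨ vanish (x²+4 x) (sgn (s *ℕ 0)) (F s x) (F (2 *ℕ s *ℕ 0) x) (sgn (suc s)) (L (s *ℕ 1) x) ⟩
  sgn (suc s) * 0ℚ + 0ℚ * L (s *ℕ 1) x * F s x
    ≡⟨ cong (λ i → sgn (suc s) * F i x + 0ℚ * L (s *ℕ 1) x * F s x) (sym (*-zeroʳ (2 *ℕ s))) ⟩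
  sgn (suc s) * F (2 *ℕ s *ℕ 0) x + 0ℚ * L (s *ℕ 1) x * F s x ∎
  where
  vanish : ∀ D e f G c l → D * (e * f * (e * 0ℚ * G)) * f ≡ c * 0ℚ + 0ℚ * l * f
  vanish = solve-∀ ℚ-ring
invariant s x (suc q) =
  invariant-step {D = x²+4 x} {ε = sgn s} {f = F s x} {T = lhs s x q} {N = ℕ→ℚ q}
                 (ℕ→ℚ-suc q) (lhs-suc s x q) F-step L-step (invariant s x q)
  where
  F-step : F (2 *ℕ s *ℕ suc q) x ≡ sgn s * F (2 *ℕ s *ℕ q) x + F s x * L (s *ℕ (2 *ℕ q +ℕ 1)) x
  F-step = begin
    F (2 *ℕ s *ℕ suc q) x                            ≡⟨ cong (λ i → F i x) (index₁ s q) ⟩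
    F (2 *ℕ s *ℕ q +ℕ (s +ℕ s)) x                    ≡⟨ F-double-shift x (2 *ℕ s *ℕ q) s ⟩
    sgn s * F (2 *ℕ s *ℕ q) x + F s x * L (2 *ℕ s *ℕ q +ℕ s) x
                                                     ≡⟨ cong (λ i → sgn s * F (2 *ℕ s *ℕ q) x + F s x * L i x) (index₂ s q) ⟩
    sgn s * F (2 *ℕ s *ℕ q) x + F s x * L (s *ℕ (2 *ℕ q +ℕ 1)) x ∎
    where
    index₁ : ∀ s q → 2 *ℕ s *ℕ suc q ≡ 2 *ℕ s *ℕ q +ℕ (s +ℕ s)
    index₁ = ℕ-Ring.solve-∀
    index₂ : ∀ s q → 2 *ℕ s *ℕ q +ℕ s ≡ s *ℕ (2 *ℕ q +ℕ 1)
    index₂ = ℕ-Ring.solve-∀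
  L-step : L (s *ℕ (2 *ℕ suc q +ℕ 1)) x
             ≡ sgn s * L (s *ℕ (2 *ℕ q +ℕ 1)) x + F s x * (x²+4 x * F (2 *ℕ s *ℕ suc q) x)
  L-step = begin
    L (s *ℕ (2 *ℕ suc q +ℕ 1)) x                     ≡⟨ cong (λ i → L i x) (index₃ s q) ⟩
    L (m +ℕ (s +ℕ s)) x                              ≡⟨ L-double-shift x m s ⟩
    sgn s * L m x + F s x * (x²+4 x * F (m +ℕ s) x)  ≡⟨ cong (λ i → sgn s * L m x + F s x * (x²+4 x * F i x)) (index₄ s q) ⟩
    sgn s * L m x + F s x * (x²+4 x * F (2 *ℕ s *ℕ suc q) x) ∎
    where
    m = s *ℕ (2 *ℕ q +ℕ 1)
    index₃ : ∀ s q → s *ℕ (2 *ℕ suc q +ℕ 1) ≡ s *ℕ (2 *ℕ q +ℕ 1) +ℕ (s +ℕ s)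
    index₃ = ℕ-Ring.solve-∀
    index₄ : ∀ s q → s *ℕ (2 *ℕ q +ℕ 1) +ℕ s ≡ 2 *ℕ s *ℕ suc q
    index₄ = ℕ-Ring.solve-∀

divide-out : ∀ y f d c A B .{{_ : NonZero f}} .{{_ : NonZero d}} →
             d * y * f ≡ c * A + B * f → y ≡ (c ÷ f * A + B) ÷ d
divide-out y f d c A B hyp = begin
  y                                     ≡⟨ sym (units y) ⟩
  y * 1ℚ * 1ℚ                           ≡⟨ cong₂ (λ u v → y * u * v) (sym (*-inverseʳ f)) (sym (*-inverseʳ d)) ⟩
  y * (f * 1/ f) * (d * 1/ d)           ≡⟨ reorder y f (1/ f) d (1/ d) ⟩
  d * y * f * 1/ f * 1/ d               ≡⟨ cong (λ t → t * 1/ f * 1/ d) hyp ⟩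
  (c * A + B * f) * 1/ f * 1/ d         ≡⟨ distribute c A B f (1/ f) (1/ d) ⟩
  (c * 1/ f * A + B * (f * 1/ f)) * 1/ d ≡⟨ cong (λ u → (c * 1/ f * A + B * u) * 1/ d) (*-inverseʳ f) ⟩
  (c * 1/ f * A + B * 1ℚ) * 1/ d        ≡⟨ cong (λ u → (c * 1/ f * A + u) * 1/ d) (*-identityʳ B) ⟩
  (c * 1/ f * A + B) * 1/ d             ∎
  where
  units : ∀ y → y * 1ℚ * 1ℚ ≡ y
  units = solve-∀ ℚ-ring
  reorder : ∀ y f i d j → y * (f * i) * (d * j) ≡ d * y * f * i * j
  reorder = solve-∀ ℚ-ring
  distribute : ∀ c A B f i j → (c * A + B * f) * i * j ≡ (c * i * A + B * (f * i)) * j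
  distribute = solve-∀ ℚ-ring

mainTheorem8 : (s : ℕ) → 1 ≤ s → (q : ℕ) → (x : ℚ) → (hF : F s x ≢ 0ℚ) →
    sgn (s *ℕ q) * F s x * Σ0to q (λ n → sgn (s *ℕ n) * ℕ→ℚ n * F (2 *ℕ s *ℕ n) x)
      ≡ _÷_ (_÷_ (sgn (s +ℕ 1)) (F s x) {{≢-nonZero hF}} * F (2 *ℕ s *ℕ q) x
                + ℕ→ℚ q * L (s *ℕ (2 *ℕ q +ℕ 1)) x)
            (x²+4 x) {{x²+4-nonZero x}}
mainTheorem8 s _ q x hF =
  divide-out (lhs s x q) (F s x) (x²+4 x) (sgn (s +ℕ 1)) (F (2 *ℕ s *ℕ q) x)
             (ℕ→ℚ q * L (s *ℕ (2 *ℕ q +ℕ 1)) x)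
             {{≢-nonZero hF}} {{x²+4-nonZero x}}
             (begin
               x²+4 x * lhs s x q * F s x
                 ≡⟨ invariant s x q ⟩
               sgn (suc s) * F (2 *ℕ s *ℕ q) x + ℕ→ℚ q * L (s *ℕ (2 *ℕ q +ℕ 1)) x * F s x
                 ≡⟨ cong (λ i → sgn i * F (2 *ℕ s *ℕ q) x + ℕ→ℚ q * L (s *ℕ (2 *ℕ q +ℕ 1)) x * F s x)
                         (+-comm 1 s) ⟩
               sgn (s +ℕ 1) * F (2 *ℕ s *ℕ q) x + ℕ→ℚ q * L (s *ℕ (2 *ℕ q +ℕ 1)) x * F s x ∎)
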